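{- There are constants $c,c'>0$ such that the following hold. (a) For every event graph $G$ with $n$ nodes, letting $\mathcal C$ be the unique sink component of $\mathrm{dec}(G)$, every node $(v,X)$ of $\mathcal C$ has a certifying walk with at most $cn^2$ nodes (i.e., a minimum-length certifying walk has length $O(n^2)$), and consequently the diameter of $\mathcal C$ (the maximum over ordered pairs of nodes of $\mathcal C$ of the length of a shortest directed walk between them) is $O(n^2)$. (b) These bounds are tight: for infinitely many $n$ there is an event graph $G$ with $n$ nodes and a node $(v,X)$ of the unique sink component $\mathcal C$ of $\mathrm{dec}(G)$ such that every certifying walk for $(v,X)$ has at least $c'n^2$ nodes, and the diameter of $\mathcal C$ is at least $c'n^2$.
   Context: An event graph is a finite, connected, undirected graph $G=(V,E)$ in which every node $v$ carries a label $\texttt{i}x_v$ (insert) or $\texttt{d}x_v$ (delete), with $x_v$ in a finite universe $\mathcal U$; let $\mathcal U_{|V}=\{x_v:v\in V\}$, and assume every $x\in\mathcal U_{|V}$ has at least one node labeled $\texttt{i}x$ and one labeled $\texttt{d}x$. The decorated graph $\mathrm{dec}(G)$ is the directed graph on $V\times 2^{\mathcal U_{|V}}$ with an edge $((u,X),(v,Y))$ iff $\{u,v\}\in E$ and $Y=X\cup\{x_v\}$ (if $v$ is labeled $\texttt{i}x_v$) or $Y=X\setminus\{x_v\}$ (if $v$ is labeled $\texttt{d}x_v$). It has exactly one sink component (strongly connected component with no outgoing edges), denoted $\mathcal C$. A walk is a finite sequence of nodes with consecutive nodes adjacent. A certifying walk for a node $(v,X)$ is a closed walk $W$ in $G$ that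 starts and ends at $v$, contains for each $x\in\mathcal U_{|V}$ at least one node labeled $\texttt{i}x$ or $\texttt{d}x$, and such that for each $x\in\mathcal U_{|V}$, $x\in X$ iff the last node of $W$ referring to $x$ is labeled $\texttt{i}x$ (and $x\notin X$ iff it is labeled $\texttt{d}x$). A node $(v,X)$ lies in $\mathcal C$ iff it has a certifying walk. -}

module Defs where

open import Data.Nat using (ℕ; zero; suc; _+_; _*_; _≤_; _^_)
open import Data.Fin using (Fin; _≟_)
open import Data.Fin.Subset using (Subset; _∈_; _∪_; ⁅_⁆; _-_)
open import Data.Bool using (Bool; true; false; if_then_else_)
open import Data.Maybe using (Maybe; just; nothing)
open import Data.List using (List; []; _∷_; length; last)
open import Data.List.Relation.Unary.Linked using (Linked)
open import Data.Vec using (lookup)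
open import Data.Product using (Σ; ∃; _×_; _,_)
open import Data.Empty using (⊥)
open import Relation.Nullary using (¬_; does)
open import Relation.Binary.PropositionalEquality using (_≡_)

-- Labels: a node v carries (ins v, lab v); ins v ≡ true means "i x_v",
-- ins v ≡ false means "d x_v".  The universe U is Fin m.
-- The graph is simple: symmetric, irreflexive adjacency on Fin n.
record EventGraph (n m : ℕ) : Set₁ where
  field
    Adj        : Fin n → Fin n → Set
    Adj-sym    : ∀ {u v} → Adj u v → Adj v u
    Adj-irrefl : ∀ {u} → ¬ Adj u u
    lab        : Fin n → Fin m
    ins        : Fin n → Bool
    connected  : ∀ u v → Σ (List (Fin n)) λ ws →
                   Linked Adj (u ∷ ws) × last (u ∷ ws) ≡ just v
    hasIns     : ∀ v → ∃ λ w → lab w ≡ lab v × ins w ≡ true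
    hasDel     : ∀ v → ∃ λ w → lab w ≡ lab v × ins w ≡ false

module _ {n m : ℕ} (G : EventGraph n m) where
  open EventGraph G

  Used : Fin m → Set
  Used x = ∃ λ v → lab v ≡ x

  -- nodes of dec(G): (v , X) with X ⊆ U_{|V}
  DNode : Set
  DNode = Fin n × Subset m

  ValidD : DNode → Set
  ValidD (v , X) = ∀ x → x ∈ X → Used x

  apply : Fin n → Subset m → Subset m
  apply v X = if ins v then X ∪ ⁅ lab v ⁆ else X - lab v

  DEdge : DNode → DNode → Set
  DEdge (u , X) (v , Y) = Adj u v × Y ≡ apply v X

  data DPath : DNode → DNode → ℕ → Set where
    here  : ∀ {p} → DPath p p zero
    there : ∀ {p q r k} → DEdge p q → DPath q r k → DPath p r (suc k)

  Reach : DNode → DNode → Set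
  Reach p q = ∃ λ k → DPath p q k

  -- membership in the (unique) sink component C of dec(G):
  -- p is a node of dec(G) and everything reachable from p reaches back to p
  InSink : DNode → Set
  InSink p = ValidD p × (∀ q → Reach p q → Reach q p)

  -- label of the last node of a walk referring to x:
  -- just true = "i x", just false = "d x", nothing = no node refers to x
  lastRef : List (Fin n) → Fin m → Maybe Bool
  lastRef [] x = nothing
  lastRef (u ∷ us) x with lastRef us x
  ... | just b  = just b
  ... | nothing = if does (lab u ≟ x) then just (ins u) else nothing

  Certifying : DNode → List (Fin n) → Set
  Certifying (v , X) W =
    Σ (List (Fin n)) λ ws → W ≡ v ∷ ws ×
      Linked Adj W × last W ≡ just v ×
      (∀ x → Used x → lastRef W x ≡ just (lookup X x))

module Submission where

-- A node (v , X) of the sink has a certifying walk: walk from v through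
-- every node of G and then back to (v , X) in dec(G), which the sink permits; this closed
-- walk refers to every label and its run fixes X. It is shortened by cutting at the first
-- node w whose label is never referenced again: the part before w may be replaced by a
-- simple path (each label it refers to is referred to again from w on), and w is never
-- revisited, so at most n pieces of length < n remain. Conversely a certifying walk for
-- (v , X), preceded by a simple path to v, leads from any node of dec(G) to (v , X), so
-- the diameter is at most n + 1 + n².
--
-- On the path whose labels read K, …, 1, 0, 0, 1, …, K, with inserts on the
-- left and deletes on the right, take X in which consecutive labels have opposite
-- membership. The last references to t + 1 and t then lie on opposite sides, and a walk
-- from one to the other has length 2t + 2, so a certifying walk has length about K² = n²/4.
-- A path in dec(G) between the two alternating sets flips every label and obeys the same
-- bound.

open import Defs
open import Data.Nat using (ℕ; zero; suc; _+_; _*_; _∸_; _^_; _≤_; _<_; z≤n; s≤s; _<?_)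
open import Data.Nat.Properties
  using ( ≤-refl; ≤-trans; ≤-reflexive; ≤-pred; <⇒≤; <⇒≱; ≮⇒≥; ≤∧≢⇒<; m≤n⇒m<n∨m≡n
        ; n≤1+n; n<1+n; 1+n≢n; 1+n≰n; m<n⇒m<1+n; m≤m+n; m≤n+m; m+n≮m
        ; +-comm; +-suc; +-identityʳ; +-mono-≤; +-monoˡ-≤; +-monoʳ-≤; +-monoʳ-<; +-cancelˡ-≤; suc-injective; *-monoʳ-≤
        ; m∸n≤m; ∸-monoˡ-≤; ∸-monoʳ-≤; +-∸-assoc; m∸n+n≡m; m+n∸m≡n; m+n∸n≡m; m+[n∸m]≡n; m∸[m∸n]≡n )
  renaming (_≟_ to _≟ℕ_)
open import Data.Nat.Tactic.RingSolver using (solve-∀)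
open import Data.Fin using (Fin; toℕ; _≟_)
open import Data.Fin.Properties using (any?; injective⇒≤; toℕ≤pred[n]; toℕ-injective)
open import Data.Fin.Subset using (Subset; ⁅_⁆; _─_)
open import Data.Bool using (Bool; true; false; not; if_then_else_; _∨_)
open import Data.Bool.Properties using (∨-zeroʳ; ∨-identityʳ; not-¬)
open import Data.Maybe using (Maybe; just; nothing; fromMaybe; _<∣>_)
import Data.Maybe as Maybe
open import Data.Maybe.Properties using (just-injective; <∣>-assoc; <∣>-identityʳ; <∣>-idem)
open import Data.List using (List; []; _∷_; length; last; _++_; [_]; map; foldl; allFin)
import Data.List as List
open import Data.List.Properties using (last-map; length-map; length-++; length-tabulate; foldl-++; ++-assoc)
open import Data.List.Relation.Unary.Linked using (Linked; [-]; _∷_) renaming (map to Linked-map; tail to Linked-tail)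
import Data.List.Relation.Unary.Linked.Properties as Linked
open import Data.List.Relation.Unary.Any using (Any; here; there; satisfied)
import Data.List.Relation.Unary.Any as Any
import Data.List.Relation.Unary.Any.Properties as Any
import Data.List.Relation.Unary.All as All
open import Data.List.Relation.Unary.All.Properties using (¬Any⇒All¬)
open import Data.List.Relation.Unary.AllPairs using (_∷_)
import Data.List.Relation.Unary.AllPairs as AllPairs
open import Data.List.Relation.Unary.Unique.Propositional using (Unique)
open import Data.List.Membership.Propositional using (_∈_; _∉_; find; lose)
open import Data.List.Membership.Propositional.Properties using (∈-∃++; ∈-++⁺ˡ; ∈-++⁺ʳ; ∈-++⁻; ∈-lookup; ∈-map⁻; ∈-allFin)
open import Data.List.Relation.Binary.Subset.Propositional using (_⊆_)
open import Data.List.Relation.Binary.Subset.Propositional.Properties using (⊆-trans; ∷⁺ʳ; Any-resp-⊆)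
open import Data.Vec using (Vec; _∷_; lookup; tabulate)
open import Data.Vec.Properties using (lookup-zipWith; lookup-replicate; lookup⇒[]=; []=⇒lookup; tabulate∘lookup; tabulate-cong; lookup∘tabulate)
open import Data.Product using (Σ; ∃; ∃₂; _×_; _,_; proj₁; proj₂)
open import Data.Sum using (_⊎_; inj₁; inj₂)
open import Data.Empty using (⊥-elim)
open import Function using (_∘_; id)
open import Relation.Nullary using (¬_; Dec; does; yes; no)
open import Relation.Binary.Definitions using (DecidableEquality)
open import Relation.Binary.PropositionalEquality
  using (_≡_; _≢_; _≗_; refl; sym; trans; cong; subst; subst₂; module ≡-Reasoning)

module _ {A : Set} where

  last-++-∷ : ∀ (xs : List A) y ys → last (xs ++ y ∷ ys) ≡ last (y ∷ ys)
  last-++-∷ []           y ys = refl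
  last-++-∷ (x ∷ [])     y ys = refl
  last-++-∷ (x ∷ z ∷ xs) y ys = last-++-∷ (z ∷ xs) y ys

  ⊆-∉-++ : ∀ {x : A} xs zs {ys} → ys ⊆ xs ++ x ∷ zs → x ∉ ys → ys ⊆ xs ++ zs
  ⊆-∉-++ xs zs ys⊆ x∉ys y∈ys with ∈-++⁻ xs (ys⊆ y∈ys)
  ... | inj₁ y∈xs         = ∈-++⁺ˡ y∈xs
  ... | inj₂ (here refl)  = ⊥-elim (x∉ys y∈ys)
  ... | inj₂ (there y∈zs) = ∈-++⁺ʳ xs y∈zs

  length-++-∷ : ∀ (xs : List A) y ys → length (xs ++ y ∷ ys) ≡ suc (length (xs ++ ys))
  length-++-∷ []       y ys = refl
  length-++-∷ (x ∷ xs) y ys = cong suc (length-++-∷ xs y ys)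

  Unique-++⁻ʳ : ∀ xs {ys : List A} → Unique (xs ++ ys) → Unique ys
  Unique-++⁻ʳ []       u       = u
  Unique-++⁻ʳ (_ ∷ xs) (_ ∷ u) = Unique-++⁻ʳ xs u

  Unique⇒lookup-injective : ∀ {xs : List A} → Unique xs → ∀ {i j} → List.lookup xs i ≡ List.lookup xs j → i ≡ j
  Unique⇒lookup-injective (_  ∷ _) {Fin.zero}  {Fin.zero}  _ = refl
  Unique⇒lookup-injective (x≢ ∷ _) {Fin.zero}  {Fin.suc j} e = ⊥-elim (All.lookup x≢ (∈-lookup j) e)
  Unique⇒lookup-injective (x≢ ∷ _) {Fin.suc i} {Fin.zero}  e = ⊥-elim (All.lookup x≢ (∈-lookup i) (sym e))
  Unique⇒lookup-injective (_  ∷ u) {Fin.suc i} {Fin.suc j} e = cong Fin.suc (Unique⇒lookup-injective u e)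

Unique⇒length≤ : ∀ {n} {xs : List (Fin n)} → Unique xs → length xs ≤ n
Unique⇒length≤ u = injective⇒≤ (Unique⇒lookup-injective u)

Walk : {A : Set} → (A → A → Set) → A → List A → A → Set
Walk R u us v = Linked R (u ∷ us) × last (u ∷ us) ≡ just v

module _ {A : Set} {R : A → A → Set} where

  walk-[] : ∀ {u} → Walk R u [] u
  walk-[] = [-] , refl

  walk-∷ : ∀ {u u′ us v} → R u u′ → Walk R u′ us v → Walk R u (u′ ∷ us) v
  walk-∷ r (l , e) = r ∷ l , e

  walk-++ : ∀ {u xs v ys w} → Walk R u xs v → Walk R v ys w → Walk R u (xs ++ ys) w
  walk-++ {xs = []}     ([-] , refl) q = q
  walk-++ {xs = _ ∷ xs} (r ∷ l , e)  q = walk-∷ r (walk-++ {xs = xs} (l , e) q)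

  walk-split : ∀ {u} xs {y ys w} → Walk R u (xs ++ y ∷ ys) w → Walk R u (xs ++ [ y ]) y × Walk R y ys w
  walk-split []       (r ∷ l , e) = walk-∷ r walk-[] , l , e
  walk-split (x ∷ xs) (r ∷ l , e) with walk-split xs (l , e)
  ... | p , q = walk-∷ r p , q

  walk-end∈ : ∀ {u us v} → Walk R u us v → v ∈ u ∷ us
  walk-end∈ {us = []}    ([-] , refl) = here refl
  walk-end∈ {us = _ ∷ _} (_ ∷ l , e)  = there (walk-end∈ (l , e))

  walk-map : ∀ {B : Set} {S : B → B → Set} (f : A → B) → (∀ {a b} → R a b → S (f a) (f b)) →
             ∀ {u us v} → Walk R u us v → Walk S (f u) (map f us) (f v)
  walk-map f f-hom {u} {us} (l , e) = Linked.map⁺ (Linked-map f-hom l) , trans (last-map f (u ∷ us)) (cong (Maybe.map f) e)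

  walk-suffix : ∀ P {u S v} → Linked R (P ++ u ∷ S) → last (P ++ u ∷ S) ≡ just v → Walk R u S v
  walk-suffix P {u} {S} l e = linked-suffix P l , trans (sym (last-++-∷ P u S)) e
    where
    linked-suffix : ∀ P {ys} → Linked R (P ++ ys) → Linked R ys
    linked-suffix []      l = l
    linked-suffix (_ ∷ P) l = linked-suffix P (Linked-tail l)

module _ {A : Set} (_≟_ : DecidableEquality A) {R : A → A → Set} where
  open import Data.List.Membership.DecPropositional _≟_ using (_∈?_)

  erase-loops : ∀ {u us v} → Walk R u us v → ∃ λ s → Walk R u s v × s ⊆ us × Unique (u ∷ s)
  erase-loops {us = []} w = [] , w , (λ ()) , All.[] ∷ AllPairs.[]
  erase-loops {u} {us = u′ ∷ us} (r ∷ l , e) with erase-loops (l , e)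
  ... | s , w , s⊆us , uniq with u ∈? u′ ∷ s
  ... | no u∉ = u′ ∷ s , walk-∷ r w , ∷⁺ʳ u′ s⊆us , ¬Any⇒All¬ _ u∉ ∷ uniq
  ... | yes u∈ with ∈-∃++ u∈
  ... | B , C , eq =
    C , proj₂ (walk-split B (subst (λ z → Walk R u z _) eq (walk-∷ r w))) ,
    ⊆-trans (subst (C ⊆_) (sym eq) (λ y∈C → ∈-++⁺ʳ B (there y∈C))) (∷⁺ʳ u′ s⊆us) ,
    Unique-++⁻ʳ B (subst Unique eq uniq)

fromMaybe-<∣> : ∀ {A : Set} (d : A) a b → fromMaybe (fromMaybe d b) a ≡ fromMaybe d (a <∣> b)
fromMaybe-<∣> d (just _) b = refl
fromMaybe-<∣> d nothing  b = refl

<∣>-congʳ-nothing : ∀ {A : Set} (a : Maybe A) {b c} → (a ≡ nothing → b ≡ c) → a <∣> b ≡ a <∣> c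
<∣>-congʳ-nothing (just _) _   = refl
<∣>-congʳ-nothing nothing  b≡c = b≡c refl

lookup-⁅⁆ : ∀ {m} (y x : Fin m) → lookup ⁅ y ⁆ x ≡ does (y ≟ x)
lookup-⁅⁆ Fin.zero    Fin.zero    = refl
lookup-⁅⁆ Fin.zero    (Fin.suc x) = lookup-replicate x false
lookup-⁅⁆ (Fin.suc y) Fin.zero    = refl
lookup-⁅⁆ (Fin.suc y) (Fin.suc x) with y ≟ x | lookup-⁅⁆ y x
... | yes _ | e = e
... | no  _ | e = e

lookup-─ : ∀ {m} (X Z : Subset m) x → lookup (X ─ Z) x ≡ (if lookup Z x then false else lookup X x)
lookup-─ (_ ∷ _) (true  ∷ _) Fin.zero    = refl
lookup-─ (_ ∷ _) (false ∷ _) Fin.zero    = refl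
lookup-─ (_ ∷ X) (_     ∷ Z) (Fin.suc x) = lookup-─ X Z x

lookup-extensional : ∀ {A : Set} {k} (xs ys : Vec A k) → (∀ i → lookup xs i ≡ lookup ys i) → xs ≡ ys
lookup-extensional xs ys eq = trans (sym (tabulate∘lookup xs)) (trans (tabulate-cong eq) (tabulate∘lookup ys))

module Semantics {n m : ℕ} (G : EventGraph n m) where
  open EventGraph G
  open ≡-Reasoning

  Refers : List (Fin n) → Fin m → Set
  Refers L x = Any (λ u → lab u ≡ x) L

  lastRef-[-] : ∀ {u x} → lab u ≡ x → lastRef G [ u ] x ≡ just (ins u)
  lastRef-[-] {u} {x} lu with lab u ≟ x
  ... | yes _  = refl
  ... | no ¬lu = ⊥-elim (¬lu lu)

  lastRef-∷ : ∀ u us x → lastRef G (u ∷ us) x ≡ lastRef G us x <∣> lastRef G [ u ] x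
  lastRef-∷ u us x with lastRef G us x
  ... | just _  = refl
  ... | nothing = refl

  lastRef-++ : ∀ us vs x → lastRef G (us ++ vs) x ≡ lastRef G vs x <∣> lastRef G us x
  lastRef-++ []       vs x = sym (<∣>-identityʳ _)
  lastRef-++ (u ∷ us) vs x = begin
    lastRef G (u ∷ us ++ vs) x                                 ≡⟨ lastRef-∷ u (us ++ vs) x ⟩
    lastRef G (us ++ vs) x <∣> lastRef G [ u ] x               ≡⟨ cong (_<∣> _) (lastRef-++ us vs x) ⟩
    (lastRef G vs x <∣> lastRef G us x) <∣> lastRef G [ u ] x  ≡⟨ <∣>-assoc (lastRef G vs x) _ _ ⟩
    lastRef G vs x <∣> (lastRef G us x <∣> lastRef G [ u ] x)  ≡⟨ cong (_ <∣>_) (sym (lastRef-∷ u us x)) ⟩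
    lastRef G vs x <∣> lastRef G (u ∷ us) x                    ∎

  lastRef-join : ∀ h s {w} → last (h ∷ s) ≡ just w →
                 ∀ r x → lastRef G (h ∷ s ++ r) x ≡ lastRef G (w ∷ r) x <∣> lastRef G (h ∷ s) x
  lastRef-join h [] refl r x = begin
    lastRef G (h ∷ r) x                                             ≡⟨ lastRef-∷ h r x ⟩
    lastRef G r x <∣> lastRef G [ h ] x                             ≡⟨ cong (lastRef G r x <∣>_) (sym (<∣>-idem _)) ⟩
    lastRef G r x <∣> (lastRef G [ h ] x <∣> lastRef G [ h ] x)     ≡⟨ sym (<∣>-assoc (lastRef G r x) _ _) ⟩
    (lastRef G r x <∣> lastRef G [ h ] x) <∣> lastRef G [ h ] x     ≡⟨ cong (_<∣> _) (sym (lastRef-∷ h r x)) ⟩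
    lastRef G (h ∷ r) x <∣> lastRef G [ h ] x                       ∎
  lastRef-join h (u ∷ s) {w} e r x = begin
    lastRef G (h ∷ u ∷ s ++ r) x                                       ≡⟨ lastRef-∷ h (u ∷ s ++ r) x ⟩
    lastRef G (u ∷ s ++ r) x <∣> lastRef G [ h ] x                     ≡⟨ cong (_<∣> _) (lastRef-join u s e r x) ⟩
    (lastRef G (w ∷ r) x <∣> lastRef G (u ∷ s) x) <∣> lastRef G [ h ] x ≡⟨ <∣>-assoc (lastRef G (w ∷ r) x) _ _ ⟩
    lastRef G (w ∷ r) x <∣> (lastRef G (u ∷ s) x <∣> lastRef G [ h ] x) ≡⟨ cong (_ <∣>_) (sym (lastRef-∷ h (u ∷ s) x)) ⟩
    lastRef G (w ∷ r) x <∣> lastRef G (h ∷ u ∷ s) x                    ∎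

  ¬Refers⇒lastRef≡nothing : ∀ {L x} → ¬ Refers L x → lastRef G L x ≡ nothing
  ¬Refers⇒lastRef≡nothing {[]}    _ = refl
  ¬Refers⇒lastRef≡nothing {u ∷ L} {x} ¬r
    rewrite ¬Refers⇒lastRef≡nothing {L} (λ r → ¬r (there r)) with lab u ≟ x
  ... | yes p = ⊥-elim (¬r (here p))
  ... | no  _ = refl

  Refers⇒lastRef≡just : ∀ {L x} → Refers L x → ∃ λ b → lastRef G L x ≡ just b
  Refers⇒lastRef≡just {u ∷ L} {x} r with lastRef G L x in e
  ... | just b  = b , refl
  Refers⇒lastRef≡just {u ∷ L} {x} (there r) | nothing with Refers⇒lastRef≡just r
  ... | _ , e′ with () ← trans (sym e) e′
  Refers⇒lastRef≡just {u ∷ L} {x} (here p) | nothing with lab u ≟ x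
  ... | yes _ = ins u , refl
  ... | no ¬p = ⊥-elim (¬p p)

  lastRef≡just⇒split : ∀ L {x b} → lastRef G L x ≡ just b →
    ∃₂ λ P u → ∃ λ S → L ≡ P ++ u ∷ S × lab u ≡ x × ins u ≡ b
  lastRef≡just⇒split (u ∷ L) {x} eq with lastRef G L x in e
  ... | just _ with lastRef≡just⇒split L e | eq
  ...   | P , w , S , refl , lw , iw | refl = u ∷ P , w , S , refl , lw , iw
  lastRef≡just⇒split (u ∷ L) {x} eq | nothing with lab u ≟ x | eq
  ...   | yes p | refl = [] , u , L , refl , p , refl

  lookup-apply : ∀ u X x → lookup (apply G u X) x ≡ fromMaybe (lookup X x) (lastRef G [ u ] x)
  lookup-apply u X x with ins u | lab u ≟ x | lookup-⁅⁆ (lab u) x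
  ... | true  | yes _ | e = trans (lookup-zipWith _∨_ x X ⁅ lab u ⁆) (trans (cong (lookup X x ∨_) e) (∨-zeroʳ _))
  ... | true  | no  _ | e = trans (lookup-zipWith _∨_ x X ⁅ lab u ⁆) (trans (cong (lookup X x ∨_) e) (∨-identityʳ _))
  ... | false | yes _ | e = trans (lookup-─ X ⁅ lab u ⁆ x) (cong (if_then false else lookup X x) e)
  ... | false | no  _ | e = trans (lookup-─ X ⁅ lab u ⁆ x) (cong (if_then false else lookup X x) e)

  run : Subset m → List (Fin n) → Subset m
  run = foldl (λ X u → apply G u X)

  lookup-run : ∀ us X x → lookup (run X us) x ≡ fromMaybe (lookup X x) (lastRef G us x)
  lookup-run []       X x = refl
  lookup-run (u ∷ us) X x = begin
    lookup (run (apply G u X) us) x                                          ≡⟨ lookup-run us (apply G u X) x ⟩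
    fromMaybe (lookup (apply G u X) x) (lastRef G us x)                      ≡⟨ cong (λ b → fromMaybe b (lastRef G us x)) (lookup-apply u X x) ⟩
    fromMaybe (fromMaybe (lookup X x) (lastRef G [ u ] x)) (lastRef G us x)  ≡⟨ fromMaybe-<∣> _ (lastRef G us x) _ ⟩
    fromMaybe (lookup X x) (lastRef G us x <∣> lastRef G [ u ] x)            ≡⟨ cong (fromMaybe (lookup X x)) (sym (lastRef-∷ u us x)) ⟩
    fromMaybe (lookup X x) (lastRef G (u ∷ us) x)                            ∎

  walk⇒DPath : ∀ {u us v} X → Walk Adj u us v → DPath G (u , X) (v , run X us) (length us)
  walk⇒DPath {us = []}     X ([-] , refl) = here
  walk⇒DPath {us = u ∷ us} X (r ∷ l , e)  = there (r , refl) (walk⇒DPath (apply G u X) (l , e))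

  DPath⇒walk : ∀ {u X v Y ℓ} → DPath G (u , X) (v , Y) ℓ →
               ∃ λ us → length us ≡ ℓ × Walk Adj u us v × Y ≡ run X us
  DPath⇒walk here = [] , refl , walk-[] , refl
  DPath⇒walk (there {q = u′ , _} (r , refl) p) with DPath⇒walk p
  ... | us , refl , w , eq = u′ ∷ us , refl , walk-∷ r w , eq

  ValidD-apply : ∀ {u X} v → ValidD G (u , X) → ValidD G (v , apply G v X)
  ValidD-apply {X = X} v valid x x∈ with lab v ≟ x | lookup-apply v X x
  ... | yes p | _ = v , p
  ... | no  _ | e = valid x (lookup⇒[]= x X (trans (sym e) ([]=⇒lookup x∈)))

  ValidD-DPath : ∀ {p q ℓ} → DPath G p q ℓ → ValidD G p → ValidD G q
  ValidD-DPath here valid = valid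
  ValidD-DPath (there {p = u , _} {q = v , _} (_ , refl) p) valid = ValidD-DPath p (ValidD-apply {u} v valid)

  ValidD⇒lookup-unused : ∀ {u X x} → ValidD G (u , X) → ¬ Used G x → lookup X x ≡ false
  ValidD⇒lookup-unused {X = X} {x} valid ¬used with lookup X x in e
  ... | true  = ⊥-elim (¬used (valid x (lookup⇒[]= x X e)))
  ... | false = refl

  Determines : List (Fin n) → Subset m → Set
  Determines W X = ∀ x → Used G x → lastRef G W x ≡ just (lookup X x)

  Determines-++ˡ : ∀ L W X → Determines W X → Determines (L ++ W) X
  Determines-++ˡ L W X det x used = trans (lastRef-++ L W x) (cong (_<∣> _) (det x used))

  run-Determines : ∀ {u v W X Y} → ValidD G (u , Y) → ValidD G (v , X) → Determines W X → run Y W ≡ X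
  run-Determines {u} {v} {W} {X} {Y} validY validX det =
    lookup-extensional _ _ λ x → trans (lookup-run W Y x) (run-at x)
    where
    run-at : ∀ x → fromMaybe (lookup Y x) (lastRef G W x) ≡ lookup X x
    run-at x with any? (λ u → lab u ≟ x)
    ... | yes used = cong (fromMaybe _) (det x used)
    ... | no ¬used = begin
      fromMaybe (lookup Y x) (lastRef G W x) ≡⟨ cong (fromMaybe _) (¬Refers⇒lastRef≡nothing {W} (¬used ∘ satisfied)) ⟩
      lookup Y x                              ≡⟨ ValidD⇒lookup-unused {u} validY ¬used ⟩
      false                                   ≡⟨ sym (ValidD⇒lookup-unused {v} validX ¬used) ⟩
      lookup X x                              ∎

  neighbour : ∀ v → ∃ (Adj v)
  neighbour v with hasIns v | hasDel v
  ... | i , _ , ins-i | d , _ , ins-d with connected v i | connected v d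
  ...   | a ∷ _ , v~a ∷ _ , _ | _                   = a , v~a
  ...   | [] , _ , _          | a ∷ _ , v~a ∷ _ , _ = a , v~a
  ...   | [] , _ , refl       | [] , _ , refl       with () ← trans (sym ins-i) ins-d

  -- A DPath does not apply the operation of its first node; the detour v → a → v makes the
  -- first node of the certifying walk count.
  certifying⇒DPath : ∀ {u Y v X W} → ValidD G (u , Y) → ValidD G (v , X) → Certifying G (v , X) W →
                     ∃ λ ℓ → DPath G (u , Y) (v , X) ℓ × ℓ ≤ n + length W
  certifying⇒DPath {u} {Y} {v} {X} validY validX (ws , refl , l , e , det)
    with erase-loops _≟_ (proj₂ (connected u v)) | neighbour v
  ... | s , u⇝v , _ , unique | a , v~a =
    length L ,
    subst (λ Z → DPath G (u , Y) (v , Z) (length L))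
          (run-Determines {u} {v} {L} validY validX (Determines-++ˡ (s ++ [ a ]) (v ∷ ws) X det))
          (walk⇒DPath Y walk) ,
    ≤-trans (≤-reflexive (length-++ (s ++ [ a ]))) (+-monoˡ-≤ (suc (length ws)) detour-length)
    where
    L = (s ++ [ a ]) ++ v ∷ ws
    walk : Walk Adj u L v
    walk = walk-++ (walk-++ u⇝v (walk-∷ v~a walk-[])) (walk-∷ (Adj-sym v~a) (l , e))
    detour-length : length (s ++ [ a ]) ≤ n
    detour-length = ≤-trans (≤-reflexive (trans (length-++ s) (+-comm (length s) 1))) (Unique⇒length≤ unique)

  certifying⇒InSink : ∀ {p W} → ValidD G p → Certifying G p W → InSink G p
  certifying⇒InSink {v , X} valid cert = valid , λ where
    (u , Y) (_ , path) → let ℓ , back , _ = certifying⇒DPath {u} {Y} {v} (ValidD-DPath path valid) valid cert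
                         in ℓ , back

  tour : ∀ u (targets : List (Fin n)) → ∃₂ λ us z → Walk Adj u us z × targets ⊆ u ∷ us
  tour u []       = [] , u , walk-[] , λ ()
  tour u (t ∷ ts) with connected u t | tour t ts
  ... | cs , u⇝t | us , z , t⇝z , ts⊆ = cs ++ us , z , walk-++ u⇝t t⇝z , covers
    where
    t∈ : t ∈ u ∷ cs ++ us
    t∈ = ∈-++⁺ˡ (walk-end∈ u⇝t)
    covers : t ∷ ts ⊆ u ∷ cs ++ us
    covers (here refl) = t∈
    covers (there y∈ts) with ts⊆ y∈ts
    ... | here refl   = t∈
    ... | there y∈us = ∈-++⁺ʳ (u ∷ cs) y∈us

  covering-walk : ∀ v → ∃₂ λ us z → Walk Adj v us z × (∀ y → y ∈ us)
  covering-walk v with neighbour v | tour v (allFin n)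
  ... | a , v~a | us , z , v⇝z , all⊆ =
    a ∷ v ∷ us , z , walk-∷ v~a (walk-∷ (Adj-sym v~a) v⇝z) , λ y → there (all⊆ (∈-allFin y))

  Refers? : ∀ L x → Dec (Refers L x)
  Refers? L x = Any.any? (λ u → lab u ≟ x) L

  split-at-first-final : ∀ u us → ∃₂ λ pre w → ∃ λ rest →
    u ∷ us ≡ pre ++ w ∷ rest × ¬ Refers rest (lab w) × (∀ {y} → y ∈ pre → Refers (w ∷ rest) (lab y))
  split-at-first-final u us with Refers? us (lab u)
  ... | no final = [] , u , us , refl , final , λ ()
  split-at-first-final u (u′ ∷ us) | yes later with split-at-first-final u′ us
  ... | pre , w , rest , eq , final , earlier = u ∷ pre , w , rest , cong (u ∷_) eq , final , earlier′
    where
    earlier′ : ∀ {y} → y ∈ u ∷ pre → Refers (w ∷ rest) (lab y)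
    earlier′ (there y∈pre) = earlier y∈pre
    earlier′ (here refl) with Any.++⁻ pre (subst (λ L → Refers L (lab u)) eq later)
    ... | inj₂ in-rest = in-rest
    ... | inj₁ in-pre with find in-pre
    ...   | y , y∈pre , ly = subst (Refers (w ∷ rest)) ly (earlier y∈pre)

  lastRef-∷-¬Refers : ∀ h {L x} → ¬ Refers L x → lastRef G (h ∷ L) x ≡ lastRef G [ h ] x
  lastRef-∷-¬Refers h {L} {x} ¬r = trans (lastRef-∷ h L x) (cong (_<∣> _) (¬Refers⇒lastRef≡nothing ¬r))

  lastRef-shortcut : ∀ h pre w rest {s rest′} → last (h ∷ s) ≡ just w → s ⊆ pre ++ [ w ] →
    (∀ {y} → y ∈ pre → Refers (w ∷ rest) (lab y)) →
    lastRef G (w ∷ rest′) ≗ lastRef G (w ∷ rest) →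
    lastRef G (h ∷ s ++ rest′) ≗ lastRef G (h ∷ pre ++ w ∷ rest)
  lastRef-shortcut h pre w rest {s} {rest′} s→w s⊆ earlier same x = begin
    lastRef G (h ∷ s ++ rest′) x                                ≡⟨ lastRef-join h s s→w rest′ x ⟩
    lastRef G (w ∷ rest′) x <∣> lastRef G (h ∷ s) x             ≡⟨ cong (_<∣> _) (same x) ⟩
    lastRef G (w ∷ rest) x <∣> lastRef G (h ∷ s) x              ≡⟨ <∣>-congʳ-nothing (lastRef G (w ∷ rest) x) prefixes-agree ⟩
    lastRef G (w ∷ rest) x <∣> lastRef G (h ∷ pre ++ [ w ]) x   ≡⟨ sym (lastRef-join h (pre ++ [ w ]) (last-++-∷ (h ∷ pre) w []) rest x) ⟩
    lastRef G (h ∷ (pre ++ [ w ]) ++ rest) x                    ≡⟨ cong (λ L → lastRef G (h ∷ L) x) (++-assoc pre [ w ] rest) ⟩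
    lastRef G (h ∷ pre ++ w ∷ rest) x                           ∎
    where
    prefixes-agree : lastRef G (w ∷ rest) x ≡ nothing → lastRef G (h ∷ s) x ≡ lastRef G (h ∷ pre ++ [ w ]) x
    prefixes-agree none = trans (lastRef-∷-¬Refers h (¬pre ∘ Any-resp-⊆ s⊆)) (sym (lastRef-∷-¬Refers h ¬pre))
      where
      ¬suffix : ¬ Refers (w ∷ rest) x
      ¬suffix r with () ← trans (sym none) (proj₂ (Refers⇒lastRef≡just r))
      ¬pre : ¬ Refers (pre ++ [ w ]) x
      ¬pre r with find r
      ... | y , y∈ , ly with ∈-++⁻ pre y∈
      ...   | inj₁ y∈pre       = ¬suffix (subst (Refers (w ∷ rest)) ly (earlier y∈pre))
      ...   | inj₂ (here refl) = ¬suffix (here ly)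

  -- The prefix up to w becomes a simple path, and A loses w since the rest never refers to lab w.
  compress : ∀ k (A : List (Fin n)) → length A ≡ k → ∀ {h ws v} → ws ⊆ A → Walk Adj h ws v →
    ∃ λ ws′ → Walk Adj h ws′ v × length ws′ ≤ k * n × lastRef G (h ∷ ws′) ≗ lastRef G (h ∷ ws)
  compress _       _ _ {ws = []}    _    walk = [] , walk , z≤n , λ _ → refl
  compress zero    [] _ {ws = _ ∷ _} ws⊆A _ with () ← ws⊆A (here refl)
  compress (suc k) A |A| {h} {u ∷ us} ws⊆A walk with split-at-first-final u us
  ... | pre , w , rest , eq , final , earlier with ∈-∃++ (ws⊆A (subst (w ∈_) (sym eq) (∈-++⁺ʳ pre (here refl))))
  ... | A₁ , A₂ , refl with walk-split pre (subst (λ L → Walk Adj h L _) eq walk)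
  ... | h⇝w , w⇝v
      with compress k (A₁ ++ A₂) |A₁++A₂| (⊆-∉-++ A₁ A₂ rest⊆A w∉rest) w⇝v | erase-loops _≟_ h⇝w
    where
    |A₁++A₂| : length (A₁ ++ A₂) ≡ k
    |A₁++A₂| = suc-injective (trans (sym (length-++-∷ A₁ w A₂)) |A|)
    rest⊆A : rest ⊆ A₁ ++ w ∷ A₂
    rest⊆A y∈rest = ws⊆A (subst (_ ∈_) (sym eq) (∈-++⁺ʳ pre (there y∈rest)))
    w∉rest : w ∉ rest
    w∉rest w∈rest = final (lose w∈rest refl)
  ... | rest′ , w⇝′v , rest′-length , same | s , h⇝′w , s⊆ , unique =
    s ++ rest′ ,
    walk-++ h⇝′w w⇝′v ,
    ≤-trans (≤-reflexive (length-++ s)) (+-mono-≤ (≤-trans (n≤1+n _) (Unique⇒length≤ unique)) rest′-length) ,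
    λ x → trans (lastRef-shortcut h pre w rest (proj₂ h⇝′w) s⊆ earlier same x)
                (cong (λ L → lastRef G (h ∷ L) x) (sym eq))

  covering-Determines : ∀ h {L} X → (∀ y → y ∈ L) → Determines (h ∷ L) (run X L)
  covering-Determines h {L} X covers x (u , lu) with Refers⇒lastRef≡just (lose (covers u) lu)
  ... | b , eb = begin
    lastRef G (h ∷ L) x                     ≡⟨ lastRef-∷ h L x ⟩
    lastRef G L x <∣> lastRef G [ h ] x     ≡⟨ cong (_<∣> _) eb ⟩
    just b                                  ≡⟨ cong just (cong (fromMaybe _) eb) ⟨
    just (fromMaybe _ (lastRef G L x))      ≡⟨ cong just (lookup-run L X x) ⟨
    just (lookup (run X L) x)               ∎

  InSink⇒certifying : ∀ {v X} → InSink G (v , X) → ∃ λ W → Certifying G (v , X) W × length W ≤ suc (n * n)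
  InSink⇒certifying {v} {X} (_ , returns) with covering-walk v
  ... | P , z , v⇝z , covers with returns (z , run X P) (length P , walk⇒DPath X v⇝z)
  ... | _ , back with DPath⇒walk back
  ... | B , _ , z⇝v , X≡ with compress n (allFin n) (length-tabulate id) (λ {y} _ → ∈-allFin y) (walk-++ v⇝z z⇝v)
  ... | ws , (linked , ends) , ws-length , same = v ∷ ws , (ws , refl , linked , ends , determines) , s≤s ws-length
    where
    closes : run X (P ++ B) ≡ X
    closes = trans (foldl-++ _ X P B) (sym X≡)
    determines : Determines (v ∷ ws) X
    determines x used =
      trans (same x)
            (subst (Determines (v ∷ P ++ B)) closes (covering-Determines v X (λ y → ∈-++⁺ˡ (covers y))) x used)

  Agrees : List (Fin n) → Subset m → Set
  Agrees S X = ∀ x {c} → lastRef G S x ≡ just c → c ≡ lookup X x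

  Agrees-++⁻ʳ : ∀ P S X → Agrees (P ++ S) X → Agrees S X
  Agrees-++⁻ʳ P S X agrees x {c} eq = agrees x (trans (lastRef-++ P S x) (cong (_<∣> _) eq))

  Determines⇒Agrees : ∀ S X → Determines S X → Agrees S X
  Determines⇒Agrees S X det x eq with lastRef≡just⇒split S eq
  ... | _ , u , _ , _ , lu , _ = just-injective (trans (sym eq) (det x (u , lu)))

  run-flipping-all⇒Determines : ∀ L Y → (∀ x → lookup (run Y L) x ≢ lookup Y x) → Determines L (run Y L)
  run-flipping-all⇒Determines L Y flips x _ with lastRef G L x in e
  ... | just c  = cong just (sym (trans (lookup-run L Y x) (cong (fromMaybe _) e)))
  ... | nothing = ⊥-elim (flips x (trans (lookup-run L Y x) (cong (fromMaybe _) e)))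

Step : ℕ → ℕ → Set
Step a b = suc a ≡ b ⊎ suc b ≡ a

segment : ℕ → ℕ → List ℕ
segment zero    zero    = []
segment zero    (suc b) = map suc (zero ∷ segment zero b)
segment (suc a) zero    = a ∷ segment a zero
segment (suc a) (suc b) = map suc (segment a b)

Step-suc : ∀ {a b} → Step a b → Step (suc a) (suc b)
Step-suc (inj₁ e) = inj₁ (cong suc e)
Step-suc (inj₂ e) = inj₂ (cong suc e)

segment-walk : ∀ a b → Walk Step a (segment a b) b
segment-walk zero    zero    = walk-[]
segment-walk zero    (suc b) = walk-∷ (inj₁ refl) (walk-map suc Step-suc (segment-walk zero b))
segment-walk (suc a) zero    = walk-∷ (inj₂ refl) (segment-walk a zero)
segment-walk (suc a) (suc b) = walk-map suc Step-suc (segment-walk a b)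

∈-segment : ∀ a b {y} → y ∈ segment a b → (a < y × y ≤ b) ⊎ (b ≤ y × y < a)
∈-segment zero    (suc b) (here refl) = inj₁ (s≤s z≤n , s≤s z≤n)
∈-segment zero    (suc b) (there y∈) with ∈-map⁻ suc y∈
... | y′ , y′∈ , refl with ∈-segment zero b y′∈
...   | inj₁ (_ , y′≤b) = inj₁ (s≤s z≤n , s≤s y′≤b)
∈-segment (suc a) zero    (here refl) = inj₂ (z≤n , n<1+n a)
∈-segment (suc a) zero    (there y∈) with ∈-segment a zero y∈
... | inj₁ (() , z≤n)
... | inj₂ (_ , y<a) = inj₂ (z≤n , m<n⇒m<1+n y<a)
∈-segment (suc a) (suc b) y∈ with ∈-map⁻ suc y∈
... | y′ , y′∈ , refl with ∈-segment a b y′∈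
...   | inj₁ (a<y′ , y′≤b) = inj₁ (s≤s a<y′ , s≤s y′≤b)
...   | inj₂ (b≤y′ , y′<a) = inj₂ (s≤s b≤y′ , s≤s y′<a)

walk-length-≥ : ∀ {a xs b} → Walk Step a xs b → b ≤ a + length xs × a ≤ b + length xs
walk-length-≥ {a} {[]} ([-] , refl) = m≤m+n a 0 , m≤m+n a 0
walk-length-≥ {a} {x ∷ xs} {b} (step ∷ l , e) with walk-length-≥ (l , e) | step
... | b≤ , x≤ | inj₁ refl =
  ≤-trans b≤ (≤-reflexive (sym (+-suc a (length xs)))) , ≤-trans (n≤1+n a) (≤-trans x≤ (+-monoʳ-≤ b (n≤1+n _)))
... | b≤ , x≤ | inj₂ refl =
  ≤-trans b≤ (+-mono-≤ (n≤1+n x) (n≤1+n _)) , ≤-trans (s≤s x≤) (≤-reflexive (sym (+-suc b (length xs))))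

gap≤walk-length : ∀ {a xs b} D → Walk Step a xs b → a + D ≡ b ⊎ b + D ≡ a → D ≤ length xs
gap≤walk-length {a} {xs} {b} D w (inj₁ refl) = +-cancelˡ-≤ a D (length xs) (proj₁ (walk-length-≥ w))
gap≤walk-length {a} {xs} {b} D w (inj₂ refl) = +-cancelˡ-≤ b D (length xs) (proj₂ (walk-length-≥ w))

walk-enters-up : ∀ {a xs b c} → Walk Step a xs b → a < c → c ≤ b → c ∈ xs
walk-enters-up {xs = []}     ([-] , refl) a<c c≤a = ⊥-elim (<⇒≱ a<c c≤a)
walk-enters-up {xs = x ∷ xs} {c = c} (step ∷ l , e) a<c c≤b with x ≟ℕ c
... | yes refl = here refl
... | no  x≢c  = there (walk-enters-up (l , e) (≤∧≢⇒< (x≤c step) x≢c) c≤b)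
  where
  x≤c : Step _ x → x ≤ c
  x≤c (inj₁ refl) = a<c
  x≤c (inj₂ refl) = ≤-trans (n≤1+n x) (<⇒≤ a<c)

walk-enters-down : ∀ {a xs b c} → Walk Step a xs b → c < a → b ≤ c → c ∈ xs
walk-enters-down {xs = []}     ([-] , refl) c<a a≤c = ⊥-elim (<⇒≱ c<a a≤c)
walk-enters-down {xs = x ∷ xs} {c = c} (step ∷ l , e) c<a b≤c with x ≟ℕ c
... | yes refl = here refl
... | no  x≢c  = there (walk-enters-down (l , e) (≤∧≢⇒< (c≤x step) (x≢c ∘ sym)) b≤c)
  where
  c≤x : Step _ x → c ≤ x
  c≤x (inj₁ refl) = ≤-trans (<⇒≤ c<a) (n≤1+n _)
  c≤x (inj₂ refl) = ≤-pred c<a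

-- clamp M i ≡ i only for i ≤ M; it is applied to positions of the path graph below.
clamp : ∀ M → ℕ → Fin (suc M)
clamp _       zero    = Fin.zero
clamp zero    (suc _) = Fin.zero
clamp (suc M) (suc i) = Fin.suc (clamp M i)

toℕ-clamp : ∀ {M i} → i ≤ M → toℕ (clamp M i) ≡ i
toℕ-clamp {_}     {zero}  _         = refl
toℕ-clamp {suc M} {suc i} (s≤s i≤M) = cong suc (toℕ-clamp i≤M)

clamp-toℕ : ∀ {M} (x : Fin (suc M)) → clamp M (toℕ x) ≡ x
clamp-toℕ {_}     Fin.zero    = refl
clamp-toℕ {suc M} (Fin.suc x) = cong Fin.suc (clamp-toℕ x)

clamp-injective : ∀ {M i j} → i ≤ M → j ≤ M → clamp M i ≡ clamp M j → i ≡ j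
clamp-injective i≤M j≤M eq = trans (sym (toℕ-clamp i≤M)) (trans (cong toℕ eq) (toℕ-clamp j≤M))

module PathGraph (K : ℕ) where

  k M : ℕ
  k = suc K
  M = K + k

  -- Nodes are the positions 0, …, M of a path; label t is inserted at K ∸ t and deleted at k + t.
  pos : Bool → ℕ → ℕ
  pos true  t = K ∸ t
  pos false t = k + t

  decode : ℕ → Bool × ℕ
  decode p with p <? k
  ... | yes _ = true  , K ∸ p
  ... | no  _ = false , p ∸ k

  decode-pos : ∀ c {t} → t ≤ K → decode (pos c t) ≡ (c , t)
  decode-pos true  {t} t≤K with K ∸ t <? k
  ... | yes _  = cong (true ,_) (m∸[m∸n]≡n t≤K)
  ... | no  ¬< = ⊥-elim (¬< (s≤s (m∸n≤m K t)))
  decode-pos false {t} t≤K with k + t <? k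
  ... | yes k+t<k = ⊥-elim (m+n≮m k t k+t<k)
  ... | no  _     = cong (false ,_) (m+n∸m≡n k t)

  pos-decode : ∀ {p} → p ≤ M → pos (proj₁ (decode p)) (proj₂ (decode p)) ≡ p
  pos-decode {p} _ with p <? k
  ... | yes p<k = m∸[m∸n]≡n (≤-pred p<k)
  pos-decode {p} _ | no p≮k = m+[n∸m]≡n (≮⇒≥ p≮k)

  decode-label≤ : ∀ {p} → p ≤ M → proj₂ (decode p) ≤ K
  decode-label≤ {p} p≤M with p <? k
  ... | yes _ = m∸n≤m K p
  ... | no  _ = ≤-trans (∸-monoˡ-≤ k p≤M) (≤-reflexive (m+n∸n≡m K k))

  decode-label-within : ∀ {t p} → t ≤ K → K ∸ t ≤ p → p ≤ k + t → proj₂ (decode p) ≤ t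
  decode-label-within {t} {p} t≤K K∸t≤p p≤k+t with p <? k
  ... | yes _ = ≤-trans (∸-monoʳ-≤ K K∸t≤p) (≤-reflexive (m∸[m∸n]≡n t≤K))
  ... | no  _ = ≤-trans (∸-monoˡ-≤ k p≤k+t) (≤-reflexive (m+n∸m≡n k t))

  Node : Set
  Node = Fin (suc M)

  Adj : Node → Node → Set
  Adj u v = Step (toℕ u) (toℕ v)

  lab : Node → Fin k
  lab u = clamp K (proj₂ (decode (toℕ u)))

  ins : Node → Bool
  ins u = proj₁ (decode (toℕ u))

  node : Bool → ℕ → Node
  node c t = clamp M (pos c t)

  pos≤M : ∀ c {t} → t ≤ K → pos c t ≤ M
  pos≤M true  {t} _   = ≤-trans (m∸n≤m K t) (m≤m+n K k)
  pos≤M false     t≤K = ≤-trans (+-monoʳ-≤ k t≤K) (≤-reflexive (+-comm k K))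

  toℕ-node : ∀ c {t} → t ≤ K → toℕ (node c t) ≡ pos c t
  toℕ-node c t≤K = toℕ-clamp (pos≤M c t≤K)

  decode-node : ∀ c {t} → t ≤ K → decode (toℕ (node c t)) ≡ (c , t)
  decode-node c t≤K = trans (cong decode (toℕ-node c t≤K)) (decode-pos c t≤K)

  lab-node : ∀ c {t} → t ≤ K → lab (node c t) ≡ clamp K t
  lab-node c t≤K = cong (clamp K ∘ proj₂) (decode-node c t≤K)

  ins-node : ∀ c {t} → t ≤ K → ins (node c t) ≡ c
  ins-node c t≤K = cong proj₁ (decode-node c t≤K)

  position-of-label : ∀ y {t} → t ≤ K → lab y ≡ clamp K t → toℕ y ≡ pos (ins y) t
  position-of-label y t≤K eq =
    trans (sym (pos-decode (toℕ≤pred[n] y)))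
          (cong (pos (ins y)) (clamp-injective (decode-label≤ (toℕ≤pred[n] y)) t≤K eq))

  lift : ∀ {a xs b} → (∀ {y} → y ∈ a ∷ xs → y ≤ M) → Walk Step a xs b →
         Walk Adj (clamp M a) (map (clamp M) xs) (clamp M b)
  lift {xs = []}     _     ([-] , refl)   = walk-[]
  lift {xs = x ∷ xs} bound (step ∷ l , e) =
    walk-∷ (subst₂ Step (sym (toℕ-clamp (bound (here refl)))) (sym (toℕ-clamp (bound (there (here refl))))) step)
           (lift (bound ∘ there) (l , e))

  segment-lift : ∀ {a b} → a ≤ M → b ≤ M → Walk Adj (clamp M a) (map (clamp M) (segment a b)) (clamp M b)
  segment-lift {a} {b} a≤M b≤M = lift within (segment-walk a b)
    where
    within : ∀ {y} → y ∈ a ∷ segment a b → y ≤ M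
    within (here refl) = a≤M
    within (there y∈) with ∈-segment a b y∈
    ... | inj₁ (_ , y≤b) = ≤-trans y≤b b≤M
    ... | inj₂ (_ , y<a) = ≤-trans (<⇒≤ y<a) a≤M

  line-walk : ∀ u v → ∃ λ ws → Walk Adj u ws v
  line-walk u v =
    _ , subst₂ (λ a b → Walk Adj a (map (clamp M) (segment (toℕ u) (toℕ v))) b) (clamp-toℕ u) (clamp-toℕ v)
          (segment-lift (toℕ≤pred[n] u) (toℕ≤pred[n] v))

  Step-irrefl : ∀ {a} → ¬ Step a a
  Step-irrefl (inj₁ e) = 1+n≢n e
  Step-irrefl (inj₂ e) = 1+n≢n e

  Gr : EventGraph (suc M) k
  Gr = record
    { Adj        = Adj
    ; Adj-sym    = λ { (inj₁ e) → inj₂ e ; (inj₂ e) → inj₁ e }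
    ; Adj-irrefl = Step-irrefl
    ; lab        = lab
    ; ins        = ins
    ; connected  = line-walk
    ; hasIns     = partner true
    ; hasDel     = partner false
    }
    where
    partner : ∀ c v → ∃ λ w → lab w ≡ lab v × ins w ≡ c
    partner c v = node c t , lab-node c t≤K , ins-node c t≤K
      where
      t = proj₂ (decode (toℕ v))
      t≤K = decode-label≤ (toℕ≤pred[n] v)

  open Semantics Gr

  K∸t≡1+K∸[1+t] : ∀ {t} → suc t ≤ K → K ∸ t ≡ suc (K ∸ suc t)
  K∸t≡1+K∸[1+t] = +-∸-assoc 1

  hop-within : ∀ c t → suc t ≤ K → ∀ {y} → y ∈ segment (pos (not c) (suc t)) (pos c t) → K ∸ t ≤ y × y ≤ k + t
  hop-within false t t<K y∈ with ∈-segment (pos true (suc t)) (pos false t) y∈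
  ... | inj₁ (K∸[1+t]<y , y≤k+t) = ≤-trans (≤-reflexive (K∸t≡1+K∸[1+t] t<K)) K∸[1+t]<y , y≤k+t
  ... | inj₂ (k+t≤y , y<K∸[1+t]) =
    ⊥-elim (<⇒≱ y<K∸[1+t] (≤-trans (m∸n≤m K (suc t)) (≤-trans (n≤1+n K) (≤-trans (m≤m+n k t) k+t≤y))))
  hop-within true t t<K y∈ with ∈-segment (pos false (suc t)) (pos true t) y∈
  ... | inj₁ (k+1+t<y , y≤K∸t) =
    ⊥-elim (<⇒≱ k+1+t<y (≤-trans y≤K∸t (≤-trans (m∸n≤m K t)
      (≤-trans (n≤1+n K) (≤-trans (m≤m+n k t) (+-monoʳ-≤ k (n≤1+n t)))))))
  ... | inj₂ (K∸t≤y , y<k+1+t) = K∸t≤y , ≤-pred (≤-trans y<k+1+t (≤-reflexive (+-suc k t)))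

  pos-gap : ∀ c t → suc t ≤ K →
            pos (not c) (suc t) + (2 + (t + t)) ≡ pos c t ⊎ pos c t + (2 + (t + t)) ≡ pos (not c) (suc t)
  pos-gap false t t<K = inj₁ (trans (identity (K ∸ suc t) t) (cong (λ K → suc K + t) (m∸n+n≡m t<K)))
    where
    identity : ∀ d t → d + (2 + (t + t)) ≡ suc (d + suc t) + t
    identity = solve-∀
  pos-gap true  t t<K = inj₂ (trans (identity (K ∸ t) t) (cong (λ K → suc K + suc t) (m∸n+n≡m (<⇒≤ t<K))))
    where
    identity : ∀ d t → d + (2 + (t + t)) ≡ suc (d + t) + suc t
    identity = solve-∀

  walk-enters-same-side : ∀ c t → suc t ≤ K → ∀ {xs p} → Walk Step (pos c (suc t)) xs p → K ≤ p → p ≤ k → pos c t ∈ xs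
  walk-enters-same-side true  t t<K w K≤p _   =
    walk-enters-up w (≤-reflexive (sym (K∸t≡1+K∸[1+t] t<K))) (≤-trans (m∸n≤m K t) K≤p)
  walk-enters-same-side false t t<K w _   p≤k = walk-enters-down w (+-monoʳ-< k (n<1+n t)) (≤-trans p≤k (m≤m+n k t))

alternate : Bool → ℕ → Bool
alternate b zero    = b
alternate b (suc t) = not (alternate b t)

module Alternating (K : ℕ) (b : Bool) where
  open PathGraph K
  open Semantics Gr

  X : Subset k
  X = tabulate (alternate b ∘ toℕ)

  lookup-X : ∀ {t} → t ≤ K → lookup X (clamp K t) ≡ alternate b t
  lookup-X {t} t≤K = trans (lookup∘tabulate (alternate b ∘ toℕ) (clamp K t)) (cong (alternate b) (toℕ-clamp t≤K))

  corner : ℕ → Node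
  corner t = node (alternate b t) t

  v₀ : Node
  v₀ = corner 0

  hop : ℕ → List Node
  hop t = map (clamp M) (segment (pos (alternate b (suc t)) (suc t)) (pos (alternate b t) t))

  zigzag : ℕ → List Node
  zigzag zero    = []
  zigzag (suc t) = hop t ++ zigzag t

  hop-walk : ∀ {t} → suc t ≤ K → Walk Adj (corner (suc t)) (hop t) (corner t)
  hop-walk {t} t<K = segment-lift (pos≤M (alternate b (suc t)) t<K) (pos≤M (alternate b t) (<⇒≤ t<K))

  zigzag-walk : ∀ t → t ≤ K → Walk Adj (corner t) (zigzag t) v₀
  zigzag-walk zero    _   = walk-[]
  zigzag-walk (suc t) t<K = walk-++ (hop-walk t<K) (zigzag-walk t (<⇒≤ t<K))

  zigzag-labels : ∀ t → suc t ≤ K → ∀ {y} → y ∈ zigzag (suc t) → proj₂ (decode (toℕ y)) ≤ t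
  zigzag-labels t t<K y∈ with ∈-++⁻ (hop t) y∈
  ... | inj₁ y∈hop with ∈-map⁻ (clamp M) y∈hop
  ...   | p , p∈ , refl with hop-within (alternate b t) t t<K p∈
  ...     | K∸t≤p , p≤k+t =
    subst (λ q → proj₂ (decode q) ≤ t) (sym (toℕ-clamp (≤-trans p≤k+t (pos≤M false (<⇒≤ t<K)))))
      (decode-label-within (<⇒≤ t<K) K∸t≤p p≤k+t)
  zigzag-labels (suc t) t<K y∈ | inj₂ y∈rest = ≤-trans (zigzag-labels t (<⇒≤ t<K) y∈rest) (n≤1+n t)

  zigzag-¬Refers : ∀ t → t ≤ K → ¬ Refers (zigzag t) (clamp K t)
  zigzag-¬Refers zero    _   ()
  zigzag-¬Refers (suc t) t<K r with find r
  ... | y , y∈ , ly =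
    1+n≰n (subst (_≤ t) (clamp-injective (decode-label≤ (toℕ≤pred[n] y)) t<K ly) (zigzag-labels t t<K y∈))

  zigzag-lastRef : ∀ t → t ≤ K → ∀ s → s ≤ t → lastRef Gr (corner t ∷ zigzag t) (clamp K s) ≡ just (alternate b s)
  zigzag-lastRef t t≤K s s≤t with m≤n⇒m<n∨m≡n s≤t
  ... | inj₂ refl = trans (lastRef-∷-¬Refers (corner t) (zigzag-¬Refers t t≤K))
                          (trans (lastRef-[-] {corner t} (lab-node (alternate b t) t≤K))
                                 (cong just (ins-node (alternate b t) t≤K)))
  zigzag-lastRef (suc t) t<K s _ | inj₁ (s≤s s≤t) =
    trans (lastRef-join (corner (suc t)) (hop t) (proj₂ (hop-walk t<K)) (zigzag t) (clamp K s))
          (cong (_<∣> lastRef Gr (corner (suc t) ∷ hop t) (clamp K s)) (zigzag-lastRef t (<⇒≤ t<K) s s≤t))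

  valid : ValidD Gr (v₀ , X)
  valid x _ = node true (toℕ x) , trans (lab-node true (toℕ≤pred[n] x)) (clamp-toℕ x)

  certificate : ∃ λ W → Certifying Gr (v₀ , X) W
  certificate with line-walk v₀ (corner K)
  ... | cs , v₀⇝corner = v₀ ∷ cs ++ zigzag K , cs ++ zigzag K , refl , proj₁ closed , proj₂ closed , determines
    where
    closed = walk-++ v₀⇝corner (zigzag-walk K ≤-refl)
    open ≡-Reasoning
    determines : Determines (v₀ ∷ cs ++ zigzag K) X
    determines x _ = begin
      lastRef Gr (v₀ ∷ cs ++ zigzag K) x
        ≡⟨ lastRef-join v₀ cs (proj₂ v₀⇝corner) (zigzag K) x ⟩
      lastRef Gr (corner K ∷ zigzag K) x <∣> lastRef Gr (v₀ ∷ cs) x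
        ≡⟨ cong (λ y → lastRef Gr (corner K ∷ zigzag K) y <∣> lastRef Gr (v₀ ∷ cs) x) (clamp-toℕ x) ⟨
      lastRef Gr (corner K ∷ zigzag K) (clamp K (toℕ x)) <∣> lastRef Gr (v₀ ∷ cs) x
        ≡⟨ cong (_<∣> lastRef Gr (v₀ ∷ cs) x) (zigzag-lastRef K ≤-refl (toℕ x) (toℕ≤pred[n] x)) ⟩
      just (alternate b (toℕ x))
        ≡⟨ cong just (lookup∘tabulate (alternate b ∘ toℕ) x) ⟨
      just (lookup X x)
        ∎

  v₀-InSink : InSink Gr (v₀ , X)
  v₀-InSink = certifying⇒InSink valid (proj₂ certificate)

  corner-of-label : ∀ y {t} → t ≤ K → lab y ≡ clamp K t → ins y ≡ alternate b t → y ≡ corner t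
  corner-of-label y {t} t≤K ly iy =
    toℕ-injective (trans (position-of-label y t≤K ly)
                         (trans (cong (λ c → pos c t) iy) (sym (toℕ-node (alternate b t) t≤K))))

  v₀-central : K ≤ toℕ v₀ × toℕ v₀ ≤ k
  v₀-central = subst (λ p → K ≤ p × p ≤ k) (sym (toℕ-node b z≤n)) (central b)
    where
    central : ∀ c → K ≤ pos c 0 × pos c 0 ≤ k
    central true  = ≤-refl , n≤1+n K
    central false = ≤-trans (n≤1+n K) (m≤m+n k 0) , ≤-reflexive (+-identityʳ k)

  -- On its way from corner (suc t) to the centre, a walk passes the node of label t on the same
  -- side; the last reference to t must then be the opposite corner of t, 2t + 2 steps away.
  meets-label : ∀ t → suc t ≤ K → ∀ {S} → Walk Adj (corner (suc t)) S v₀ → Refers S (clamp K t)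
  meets-label t t<K {S} walk =
    lose y∈S (cong (clamp K ∘ proj₂) (trans (cong decode (sym y-at)) (decode-pos c (<⇒≤ t<K))))
    where
    c = alternate b (suc t)
    positions : Walk Step (pos c (suc t)) (map toℕ S) (toℕ v₀)
    positions = subst (λ p → Walk Step p (map toℕ S) (toℕ v₀)) (toℕ-node c t<K) (walk-map toℕ id walk)
    entered : ∃ λ y → y ∈ S × pos c t ≡ toℕ y
    entered = ∈-map⁻ toℕ (walk-enters-same-side c t t<K positions (proj₁ v₀-central) (proj₂ v₀-central))
    y∈S = proj₁ (proj₂ entered)
    y-at = proj₂ (proj₂ entered)

  next-corner : ∀ t → suc t ≤ K → ∀ {S} → Walk Adj (corner (suc t)) S v₀ → Agrees S X →
                ∃₂ λ P S′ → S ≡ P ++ corner t ∷ S′ × suc (t + t) ≤ length P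
  next-corner t t<K {S} walk agrees with Refers⇒lastRef≡just (meets-label t t<K walk)
  ... | c , last-t with lastRef≡just⇒split S last-t
  ... | P , y , S′ , refl , ly , iy
      with corner-of-label y (<⇒≤ t<K) ly (trans iy (trans (agrees _ last-t) (lookup-X (<⇒≤ t<K))))
  ... | refl =
    P , S′ , refl ,
    ≤-pred (≤-trans (gap≤walk-length (2 + (t + t)) hop-positions (pos-gap (alternate b t) t t<K)) hop-length)
    where
    hop-positions : Walk Step (pos (alternate b (suc t)) (suc t)) (map toℕ (P ++ [ corner t ])) (pos (alternate b t) t)
    hop-positions = subst₂ (λ p q → Walk Step p (map toℕ (P ++ [ corner t ])) q)
                      (toℕ-node (alternate b (suc t)) t<K) (toℕ-node (alternate b t) (<⇒≤ t<K))
                      (walk-map toℕ id (proj₁ (walk-split P walk)))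
    hop-length : length (map toℕ (P ++ [ corner t ])) ≤ suc (length P)
    hop-length = ≤-reflexive (trans (length-map toℕ (P ++ [ corner t ])) (trans (length-++ P) (+-comm (length P) 1)))

  tail-length : ∀ t → t ≤ K → ∀ {S} → Walk Adj (corner t) S v₀ → Agrees S X → t * suc t ≤ length S
  tail-length zero    _   _    _      = z≤n
  tail-length (suc t) t<K walk agrees with next-corner t t<K walk agrees
  ... | P , S′ , refl , P-long =
    ≤-trans (step (length P) (length S′) P-long (tail-length t (<⇒≤ t<K) (proj₂ (walk-split P walk)) S′-agrees))
            (≤-reflexive (sym (length-++ P)))
    where
    S′-agrees : Agrees S′ X
    S′-agrees = Agrees-++⁻ʳ [ corner t ] S′ X (Agrees-++⁻ʳ P (corner t ∷ S′) X agrees)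
    step : ∀ p s → suc (t + t) ≤ p → t * suc t ≤ s → suc t * suc (suc t) ≤ p + suc s
    step p s p≥ s≥ = ≤-trans (≤-reflexive (identity t)) (+-mono-≤ p≥ (s≤s s≥))
      where
      identity : ∀ t → suc t * suc (suc t) ≡ suc (t + t) + suc (t * suc t)
      identity = solve-∀

  determining-walk-long : ∀ L → Linked Adj L → last L ≡ just v₀ → Determines L X → suc (K * k) ≤ length L
  determining-walk-long L linked ends determines
    with lastRef≡just⇒split L (determines (clamp K K) (node true K , lab-node true ≤-refl))
  ... | P , u , S , refl , lu , iu with corner-of-label u ≤-refl lu (trans iu (lookup-X ≤-refl))
  ... | refl = ≤-trans (s≤s (tail-length K ≤-refl (walk-suffix P linked ends) S-agrees))
                       (≤-trans (m≤n+m (suc (length S)) (length P)) (≤-reflexive (sym (length-++ P))))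
    where
    S-agrees : Agrees S X
    S-agrees = Agrees-++⁻ʳ [ corner K ] S X
                 (Agrees-++⁻ʳ P (corner K ∷ S) X (Determines⇒Agrees (P ++ corner K ∷ S) X determines))

  certificates-long : ∀ W → Certifying Gr (v₀ , X) W → suc (K * k) ≤ length W
  certificates-long _ (ws , refl , linked , ends , determines) = determining-walk-long (v₀ ∷ ws) linked ends determines

alternate-not : ∀ b t → alternate (not b) t ≡ not (alternate b t)
alternate-not b zero    = refl
alternate-not b (suc t) = cong not (alternate-not b t)

module AlternationDistance (K : ℕ) where
  open PathGraph K
  open Semantics Gr
  module A⁺ = Alternating K true
  module A⁻ = Alternating K false

  X⁺≢X⁻ : ∀ x → lookup A⁺.X x ≢ lookup A⁻.X x
  X⁺≢X⁻ x eq = not-¬ refl (begin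
    alternate true (toℕ x)        ≡⟨ lookup∘tabulate (alternate true ∘ toℕ) x ⟨
    lookup A⁺.X x                 ≡⟨ eq ⟩
    lookup A⁻.X x                 ≡⟨ lookup∘tabulate (alternate false ∘ toℕ) x ⟩
    alternate false (toℕ x)       ≡⟨ alternate-not true (toℕ x) ⟩
    not (alternate true (toℕ x))  ∎)
    where open ≡-Reasoning

  nonempty-long : ∀ {us} → Walk Adj A⁻.v₀ us A⁺.v₀ → Determines us A⁺.X → suc (K * k) ≤ length us
  nonempty-long {[]}     _                 determines with () ← determines (clamp K 0) (node true 0 , lab-node true z≤n)
  nonempty-long {u ∷ us} (_ ∷ linked , ends) determines = A⁺.determining-walk-long (u ∷ us) linked ends determines

  paths-long : ∀ ℓ → DPath Gr (A⁻.v₀ , A⁻.X) (A⁺.v₀ , A⁺.X) ℓ → suc (K * k) ≤ ℓ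
  paths-long ℓ path with DPath⇒walk path
  ... | us , refl , walk , X⁺≡run =
    nonempty-long walk (subst (Determines us) (sym X⁺≡run) (run-flipping-all⇒Determines us A⁻.X flips))
    where
    flips : ∀ x → lookup (run A⁻.X us) x ≢ lookup A⁻.X x
    flips x = subst (λ Y → lookup Y x ≢ lookup A⁻.X x) X⁺≡run (X⁺≢X⁻ x)

n+[1+n²]≤3n² : ∀ n → suc n + suc (suc n * suc n) ≤ 3 * suc n ^ 2
n+[1+n²]≤3n² n = ≤-trans (m≤m+n _ (2 * n * n + 3 * n)) (≤-reflexive (identity n))
  where
  identity : ∀ n → suc n + suc (suc n * suc n) + (2 * n * n + 3 * n) ≡ 3 * (suc n * (suc n * 1))
  identity = solve-∀

[2+2N]²≤8[1+N[1+N]] : ∀ N → suc (N + suc N) ^ 2 ≤ 8 * suc (N * suc N)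
[2+2N]²≤8[1+N[1+N]] N = ≤-trans (m≤m+n _ (4 * N * N + 4)) (≤-reflexive (identity N))
  where
  identity : ∀ N → suc (N + suc N) * (suc (N + suc N) * 1) + (4 * N * N + 4) ≡ 8 * suc (N * suc N)
  identity = solve-∀

short-certifying-walk : ∀ n m (G : EventGraph n m) (p : DNode G) → InSink G p →
                     Σ (List _) λ W → Certifying G p W × length W ≤ 3 * n ^ 2
short-certifying-walk (suc n) m G p sink =
  let W , certifying , W-short = Semantics.InSink⇒certifying G sink
  in W , certifying , ≤-trans W-short (≤-trans (m≤n+m _ (suc n)) (n+[1+n²]≤3n² n))

short-sink-path : ∀ n m (G : EventGraph n m) (p q : DNode G) → InSink G p → InSink G q →
                 Σ ℕ λ ℓ → DPath G p q ℓ × ℓ ≤ 3 * n ^ 2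
short-sink-path (suc n) m G p q (p-valid , _) q-sink@(q-valid , _) =
  let W , certifying , W-short = Semantics.InSink⇒certifying G q-sink
      ℓ , path , ℓ≤n+|W| = Semantics.certifying⇒DPath G p-valid q-valid certifying
  in ℓ , path , ≤-trans ℓ≤n+|W| (≤-trans (+-monoʳ-≤ (suc n) W-short) (n+[1+n²]≤3n² n))

lower-bounds : ∀ N → Σ ℕ λ n → N ≤ n × Σ ℕ λ m → Σ (EventGraph n m) λ G →
    (Σ (DNode G) λ p → InSink G p × (∀ W → Certifying G p W → n ^ 2 ≤ 8 * length W))
    × (Σ (DNode G) λ p → Σ (DNode G) λ q → InSink G p × InSink G q ×
         (∀ ℓ → DPath G p q ℓ → n ^ 2 ≤ 8 * ℓ))
lower-bounds N =
  suc (N + suc N) , ≤-trans (m≤m+n N (suc N)) (n≤1+n _) , suc N , PathGraph.Gr N ,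
  ((A⁺.v₀ , A⁺.X) , A⁺.v₀-InSink , λ W c → scaled (A⁺.certificates-long W c)) ,
  ((A⁻.v₀ , A⁻.X) , (A⁺.v₀ , A⁺.X) , A⁻.v₀-InSink , A⁺.v₀-InSink ,
     λ ℓ path → scaled (AlternationDistance.paths-long N ℓ path))
  where
  module A⁺ = Alternating N true
  module A⁻ = Alternating N false
  scaled : ∀ {ℓ} → suc (N * suc N) ≤ ℓ → suc (N + suc N) ^ 2 ≤ 8 * ℓ
  scaled ℓ-long = ≤-trans ([2+2N]²≤8[1+N[1+N]] N) (*-monoʳ-≤ 8 ℓ-long)

theorem1 : Σ ℕ λ c → Σ ℕ λ k → 1 ≤ c × 1 ≤ k ×
    ((∀ n m (G : EventGraph n m) (p : DNode G) → InSink G p →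
        Σ (List _) λ W → Certifying G p W × length W ≤ c * n ^ 2)
      × (∀ n m (G : EventGraph n m) (p q : DNode G) → InSink G p → InSink G q →
        Σ ℕ λ ℓ → DPath G p q ℓ × ℓ ≤ c * n ^ 2))
    × (∀ N → Σ ℕ λ n → N ≤ n × Σ ℕ λ m → Σ (EventGraph n m) λ G →
        (Σ (DNode G) λ p → InSink G p ×
           (∀ W → Certifying G p W → n ^ 2 ≤ k * length W))
        × (Σ (DNode G) λ p → Σ (DNode G) λ q → InSink G p × InSink G q ×
           (∀ ℓ → DPath G p q ℓ → n ^ 2 ≤ k * ℓ)))
theorem1 = 3 , 8 , s≤s z≤n , s≤s z≤n , (short-certifying-walk , short-sink-path) , lower-bounds
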